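{- For $d\in\mathbb{N}$ let $\mathscr{B}_d=\sum_{k=0}^{d}\frac{(d+k)!}{2^k k!(d-k)!}X^k$. Let $d$ be an odd positive integer, and let $\xi_d$ be the unique real root of $\mathscr{B}_d$. If there exists a prime divisor $p$ of $d$ such that \[\frac{\ln d}{p^{v_p(d)}\ln p}+\frac{1}{p-1}\leq 1,\] then $\xi_d$ is irrational.
   Context: $v_p(n)$ denotes the $p$-adic valuation of the integer $n$. For odd $d\ge1$, $\mathscr{B}_d$ has exactly one real root. -}

module Defs where

open import Data.Nat as ℕ using (ℕ; zero; suc; _!; NonZero)
open import Data.Nat.Properties using (m*n≢0; m^n≢0; _!≢0)
open import Data.Integer using (+_)
open import Data.Rational using (ℚ; _/_; _+_; _*_; 0ℚ; 1ℚ)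

_^ℚ_ : ℚ → ℕ → ℚ
q ^ℚ zero  = 1ℚ
q ^ℚ suc k = q * (q ^ℚ k)

den : ℕ → ℕ → ℕ
den d k = (2 ℕ.^ k ℕ.* k !) ℕ.* (d ℕ.∸ k) !

den≢0 : ∀ d k → NonZero (den d k)
den≢0 d k =
  let instance
        a : NonZero (2 ℕ.^ k)
        a = m^n≢0 2 k
        b : NonZero (k !)
        b = k !≢0
        c : NonZero (2 ℕ.^ k ℕ.* k !)
        c = m*n≢0 (2 ℕ.^ k) (k !)
        e : NonZero ((d ℕ.∸ k) !)
        e = (d ℕ.∸ k) !≢0
  in m*n≢0 (2 ℕ.^ k ℕ.* k !) ((d ℕ.∸ k) !)

coeffB : ℕ → ℕ → ℚ
coeffB d k = (+ ((d ℕ.+ k) !) / den d k) {{den≢0 d k}}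

evalUpTo : ℕ → ℕ → ℚ → ℚ
evalUpTo d zero    x = coeffB d 0 * (x ^ℚ 0)
evalUpTo d (suc n) x = evalUpTo d n x + coeffB d (suc n) * (x ^ℚ suc n)

evalB : ℕ → ℚ → ℚ
evalB d x = evalUpTo d d x

{-# OPTIONS --safe #-}
module Submission where

-- Write x = N / Q in lowest terms and clear denominators in 𝓑_d(x) = 0: with
-- a_k = (d + k)! / (k! (d − k)!) this reads Σ_{k ≤ d} a_k Nᵏ (2Q)^(d − k) = 0.
-- As a_0 = 1 and d ∣ a_k for k ≥ 1, if p ∤ Q the equation modulo p gives p ∣ (2Q)ᵈ,
-- impossible for odd p. If p ∣ Q then p ∤ N, and it suffices that v_p(a_k) + (d − k) > v_p(a_d)
-- for all k < d: then p^(v_p(a_d) + 1) divides every term but a_d Nᵈ, hence a_d Nᵈ as well.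
-- By Legendre's formula this inequality is about carries in base p. If d − k ≤ pᵛ, the
-- additions d + d and d + k carry alike, as pᵛ ∣ d; otherwise d − k > pᵛ outweighs the at most
-- log_p(2d) carries of d + d, and this is exactly what the hypothesis d^(p−1) ≤ p^(pᵛ(p−2)) buys.

open import Defs
open import Data.Nat using (ℕ; suc; _+_; _*_; _∸_; _^_; _≤_; _<_)
open import Data.Nat.Divisibility using (_∣_)
open import Data.Nat.Primality using (Prime)
open import Data.Rational using (ℚ; 0ℚ)
open import Relation.Binary.PropositionalEquality using (_≢_)
open import Relation.Nullary using (¬_)

open import Data.Nat
open import Data.Nat.Properties
open import Data.Nat.DivMod
open import Data.Nat.Divisibility
open import Data.Nat.Combinatorics using (k![n∸k]!∣n!)
open import Data.Nat.Tactic.RingSolver using (solve-∀)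
open import Data.Nat.Coprimality using (Coprime)
open import Data.Nat.Primality using (prime⇒nonTrivial; euclidsLemma)
open import Data.Nat.Induction using (<-rec)
open import Data.Integer as ℤ using (ℤ; 0ℤ; 1ℤ)
import Data.Integer.Properties as ℤ
import Data.Integer.Tactic.RingSolver as ℤ-Solver
open import Data.Integer.Divisibility.Signed as ℤ∣ using () renaming (_∣_ to _∣ℤ_)
open import Data.Rational as ℚ using (mkℚ; toℚᵘ)
import Data.Rational.Properties as ℚ
open import Data.Rational.Unnormalised as ℚᵘ using (_≃_; *≡*)
import Data.Rational.Unnormalised.Properties as ℚᵘ
open import Algebra.Bundles using (CommutativeRing)
import Algebra.Properties.CommutativeSemigroup as CommutativeSemigroupProperties
open import Data.Product using (∃; _×_; _,_; proj₁; proj₂)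
open import Data.Sum using (inj₁; inj₂; [_,_]′)
open import Data.Empty using (⊥-elim; ⊥-elim-irr)
open import Relation.Binary.PropositionalEquality
open import Relation.Nullary using (yes; no)
open import Function using (_$_; _∘_)
open import Relation.Binary using (tri<; tri≈; tri>)

open CommutativeSemigroupProperties *-commutativeSemigroup using (x∙yz≈y∙xz) renaming (interchange to *-interchange)
open CommutativeSemigroupProperties +-commutativeSemigroup
  using () renaming (interchange to +-interchange; xy∙z≈xz∙y to +-right-comm; x∙yz≈y∙xz to +-left-comm)
open CommutativeSemigroupProperties (CommutativeRing.*-commutativeSemigroup ℚᵘ.+-*-commutativeRing)
  using () renaming (interchange to ℚᵘ-interchange; x∙yz≈y∙xz to ℚᵘ-x∙yz≈y∙xz)
open CommutativeSemigroupProperties ℤ.*-commutativeSemigroup using () renaming (interchange to ℤ-interchange)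

k!*d!∣[d+k]! : ∀ d k → k ! * d ! ∣ (d + k) !
k!*d!∣[d+k]! d k =
  subst (λ n → k ! * n ! ∣ (d + k) !) (m+n∸n≡m d k) (k![n∸k]!∣n! (m≤n+m k d))

k!*[d∸k]!∣[d+k]! : ∀ {d k} → k ≤ d → k ! * (d ∸ k) ! ∣ (d + k) !
k!*[d∸k]!∣[d+k]! {d} {k} k≤d =
  ∣-trans (*-monoʳ-∣ (k !) (m≤n⇒m!∣n! (m∸n≤m d k))) (k!*d!∣[d+k]! d k)

-- 2ᵏ times the k-th coefficient of 𝓑_d
intCoeff : ℕ → ℕ → ℕ
intCoeff d k = ((d + k) ! / (k ! * (d ∸ k) !)) {{k !* (d ∸ k) !≢0}}

intCoeff-spec : ∀ {d k} → k ≤ d → intCoeff d k * (k ! * (d ∸ k) !) ≡ (d + k) !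
intCoeff-spec {d} {k} k≤d = m/n*n≡m {{k !* (d ∸ k) !≢0}} (k!*[d∸k]!∣[d+k]! k≤d)

intCoeff≢0 : ∀ {d k} → k ≤ d → NonZero (intCoeff d k)
intCoeff≢0 {d} {k} k≤d = ≢-nonZero λ intCoeff≡0 →
  ≢-nonZero⁻¹ ((d + k) !) {{(d + k) !≢0}}
    (trans (sym (intCoeff-spec k≤d)) (cong (_* (k ! * (d ∸ k) !)) intCoeff≡0))

intCoeff-0 : ∀ d → intCoeff d 0 ≡ 1
intCoeff-0 d = *-cancelʳ-≡ (intCoeff d 0) 1 (1 * d !) {{0 !* d !≢0}}
  (trans (intCoeff-spec {d} z≤n) (sym 1*[1*d!]≡[d+0]!))
  where
  1*[1*d!]≡[d+0]! : 1 * (1 * d !) ≡ (d + 0) !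
  1*[1*d!]≡[d+0]! =
    trans (*-identityˡ _) (trans (*-identityˡ _) (cong _! (sym (+-identityʳ d))))

d∣intCoeff : ∀ {d k} → 1 ≤ k → k ≤ d → d ∣ intCoeff d k
d∣intCoeff {zero} {suc _} _ ()
d∣intCoeff {suc d-1} {k} 1≤k k≤d = *-cancelʳ-∣ (k ! * (d ∸ k) !) {{k !* (d ∸ k) !≢0}} (begin
  d * (k ! * (d ∸ k) !)            ≡⟨ x∙yz≈y∙xz d (k !) ((d ∸ k) !) ⟩
  k ! * (d * (d ∸ k) !)            ∣⟨ *-monoʳ-∣ (k !) (*-monoʳ-∣ d (m≤n⇒m!∣n! (∸-monoʳ-≤ d 1≤k))) ⟩
  k ! * d !                        ∣⟨ k!*d!∣[d+k]! d k ⟩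
  (d + k) !                        ≡⟨ intCoeff-spec k≤d ⟨
  intCoeff d k * (k ! * (d ∸ k) !) ∎)
  where
  d = suc d-1
  open ∣-Reasoning

infix 4 _·_≐_

record _·_≐_ (q : ℚ) (u v : ℤ) : Set where
  constructor ·≐
  field ·≐-≃ : toℚᵘ q ℚᵘ.* (u ℚᵘ./ 1) ≃ v ℚᵘ./ 1

·≐-* : ∀ {q q′ u u′ v v′} → q · u ≐ v → q′ · u′ ≐ v′ → (q ℚ.* q′) · (u ℤ.* u′) ≐ (v ℤ.* v′)
·≐-* {q} {q′} {u} {u′} {v} {v′} (·≐ qu≐v) (·≐ q′u′≐v′) = ·≐ (begin
  toℚᵘ (q ℚ.* q′) ℚᵘ.* ((u ℚᵘ./ 1) ℚᵘ.* (u′ ℚᵘ./ 1))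
    ≈⟨ ℚᵘ.*-congʳ (ℚ.toℚᵘ-homo-* q q′) ⟩
  (toℚᵘ q ℚᵘ.* toℚᵘ q′) ℚᵘ.* ((u ℚᵘ./ 1) ℚᵘ.* (u′ ℚᵘ./ 1))
    ≈⟨ ℚᵘ-interchange (toℚᵘ q) (toℚᵘ q′) (u ℚᵘ./ 1) (u′ ℚᵘ./ 1) ⟩
  (toℚᵘ q ℚᵘ.* (u ℚᵘ./ 1)) ℚᵘ.* (toℚᵘ q′ ℚᵘ.* (u′ ℚᵘ./ 1))
    ≈⟨ ℚᵘ.*-cong qu≐v q′u′≐v′ ⟩
  (v ℚᵘ./ 1) ℚᵘ.* (v′ ℚᵘ./ 1) ∎)
  where open ℚᵘ.≃-Reasoning

·≐-*ˡ : ∀ {q u v} w → q · u ≐ v → q · (w ℤ.* u) ≐ (w ℤ.* v)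
·≐-*ˡ {q} {u} w (·≐ qu≐v) = ·≐ (ℚᵘ.≃-trans
  (ℚᵘ-x∙yz≈y∙xz (toℚᵘ q) (w ℚᵘ./ 1) (u ℚᵘ./ 1)) (ℚᵘ.*-congˡ {w ℚᵘ./ 1} qu≐v))

·≐-+ : ∀ {q q′ u v v′} → q · u ≐ v → q′ · u ≐ v′ → (q ℚ.+ q′) · u ≐ (v ℤ.+ v′)
·≐-+ {q} {q′} {u} {v} {v′} (·≐ qu≐v) (·≐ q′u≐v′) = ·≐ (begin
  toℚᵘ (q ℚ.+ q′) ℚᵘ.* (u ℚᵘ./ 1)                           ≈⟨ ℚᵘ.*-congʳ (ℚ.toℚᵘ-homo-+ q q′) ⟩
  (toℚᵘ q ℚᵘ.+ toℚᵘ q′) ℚᵘ.* (u ℚᵘ./ 1)                     ≈⟨ ℚᵘ.*-distribʳ-+ (u ℚᵘ./ 1) (toℚᵘ q) (toℚᵘ q′) ⟩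
  toℚᵘ q ℚᵘ.* (u ℚᵘ./ 1) ℚᵘ.+ toℚᵘ q′ ℚᵘ.* (u ℚᵘ./ 1)        ≈⟨ ℚᵘ.+-cong qu≐v q′u≐v′ ⟩
  (v ℚᵘ./ 1) ℚᵘ.+ (v′ ℚᵘ./ 1)                               ≈⟨ *≡* (integer-sum v v′) ⟩
  (v ℤ.+ v′) ℚᵘ./ 1 ∎)
  where
  open ℚᵘ.≃-Reasoning
  integer-sum : ∀ a b → (a ℤ.* 1ℤ ℤ.+ b ℤ.* 1ℤ) ℤ.* 1ℤ ≡ (a ℤ.+ b) ℤ.* 1ℤ
  integer-sum = ℤ-Solver.solve-∀

·≐-^ : ∀ {q u v} k → q · u ≐ v → (q ^ℚ k) · (u ℤ.^ k) ≐ (v ℤ.^ k)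
·≐-^ zero    _    = ·≐ ℚᵘ.≃-refl
·≐-^ (suc k) qu≐v = ·≐-* qu≐v (·≐-^ k qu≐v)

·≐-zero : ∀ {q u v} → q ≡ 0ℚ → q · u ≐ v → v ≡ 0ℤ
·≐-zero {u = u} refl (·≐ qu≐v) =
  ℚᵘ.p≃0⇒↥p≡0 _ (ℚᵘ.≃-trans (ℚᵘ.≃-sym qu≐v) (ℚᵘ.*-zeroˡ (u ℚᵘ./ 1)))

mkℚ·denominator≐numerator : ∀ n d-1 .(c : Coprime (ℤ.∣ n ∣) (suc d-1)) → mkℚ n d-1 c · ℤ.+ suc d-1 ≐ n
mkℚ·denominator≐numerator n d-1 c =
  ·≐ $ *≡* (trans (ℤ.*-identityʳ _) (cong (λ m → n ℤ.* ℤ.+ m) (sym (*-identityʳ (suc d-1)))))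

/·≐ : ∀ i n j a .{{_ : NonZero n}} → i * j ≡ a * n → (ℤ.+ i ℚ./ n) · ℤ.+ j ≐ ℤ.+ a
/·≐ i n@(suc n-1) j a i*j≡a*n =
  ·≐ $ ℚᵘ.≃-trans (ℚᵘ.*-congʳ (ℚ.toℚᵘ-fromℚᵘ (ℚᵘ.mkℚᵘ (ℤ.+ i) n-1))) (*≡* (begin
  (ℤ.+ i ℤ.* ℤ.+ j) ℤ.* 1ℤ ≡⟨ ℤ.*-identityʳ _ ⟩
  ℤ.+ i ℤ.* ℤ.+ j           ≡⟨ ℤ.pos-* i j ⟨
  ℤ.+ (i * j)             ≡⟨ cong ℤ.+_ i*j≡a*n ⟩
  ℤ.+ (a * n)             ≡⟨ cong (λ m → ℤ.+ (a * m)) (*-identityʳ n) ⟨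
  ℤ.+ (a * (n * 1))       ≡⟨ ℤ.pos-* a (n * 1) ⟩
  ℤ.+ a ℤ.* ℤ.+ (n * 1)     ∎))
  where open ≡-Reasoning

coeffB·2^k≐intCoeff : ∀ {d k} → k ≤ d → coeffB d k · ((ℤ.+ 2) ℤ.^ k) ≐ ℤ.+ intCoeff d k
coeffB·2^k≐intCoeff {d} {k} k≤d = subst (λ u → coeffB d k · u ≐ ℤ.+ intCoeff d k) (pos-^ 2 k)
  (/·≐ ((d + k) !) (den d k) (2 ^ k) (intCoeff d k) {{den≢0 d k}} (begin
    (d + k) ! * 2 ^ k                                ≡⟨ *-comm ((d + k) !) (2 ^ k) ⟩
    2 ^ k * (d + k) !                                ≡⟨ cong (2 ^ k *_) (intCoeff-spec k≤d) ⟨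
    2 ^ k * (intCoeff d k * (k ! * (d ∸ k) !))       ≡⟨ regroup (2 ^ k) (intCoeff d k) (k !) ((d ∸ k) !) ⟩
    intCoeff d k * den d k                           ∎))
  where
  open ≡-Reasoning
  regroup : ∀ t a f g → t * (a * (f * g)) ≡ a * ((t * f) * g)
  regroup = solve-∀
  pos-^ : ∀ a k → ℤ.+ (a ^ k) ≡ (ℤ.+ a) ℤ.^ k
  pos-^ a zero    = refl
  pos-^ a (suc k) = trans (ℤ.pos-* a (a ^ k)) (cong (ℤ.+ a ℤ.*_) (pos-^ a k))

^-distrib-*ℤ : ∀ a b k → (a ℤ.* b) ℤ.^ k ≡ a ℤ.^ k ℤ.* b ℤ.^ k
^-distrib-*ℤ a b zero    = refl
^-distrib-*ℤ a b (suc k) = trans (cong ((a ℤ.* b) ℤ.*_) (^-distrib-*ℤ a b k)) (ℤ-interchange a b (a ℤ.^ k) (b ℤ.^ k))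

∣i^k∣≡∣i∣^k : ∀ i k → ℤ.∣ i ℤ.^ k ∣ ≡ ℤ.∣ i ∣ ^ k
∣i^k∣≡∣i∣^k i zero    = refl
∣i^k∣≡∣i∣^k i (suc k) = trans (ℤ.abs-* i (i ℤ.^ k)) (cong (ℤ.∣ i ∣ *_) (∣i^k∣≡∣i∣^k i k))

-- horner t T j = Σ_{k ≤ j} t k · T ^ (j ∸ k)
horner : (ℕ → ℤ) → ℤ → ℕ → ℤ
horner t T zero    = t 0
horner t T (suc j) = T ℤ.* horner t T j ℤ.+ t (suc j)

besselTerm : ℕ → ℤ → ℕ → ℤ
besselTerm d N k = ℤ.+ intCoeff d k ℤ.* N ℤ.^ k

∣besselTerm∣ : ∀ d N k → ℤ.∣ besselTerm d N k ∣ ≡ intCoeff d k * ℤ.∣ N ∣ ^ k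
∣besselTerm∣ d N k = trans (ℤ.abs-* (ℤ.+ intCoeff d k) (N ℤ.^ k)) (cong (intCoeff d k *_) (∣i^k∣≡∣i∣^k N k))

module _ (d : ℕ) (N : ℤ) (Q-1 : ℕ) .(coprime : Coprime (ℤ.∣ N ∣) (suc Q-1)) where

  private
    x : ℚ
    x = mkℚ N Q-1 coprime

    T : ℤ
    T = ℤ.+ 2 ℤ.* ℤ.+ suc Q-1

  besselMonomial·T^k≐besselTerm : ∀ {k} → k ≤ d → (coeffB d k ℚ.* (x ^ℚ k)) · T ℤ.^ k ≐ besselTerm d N k
  besselMonomial·T^k≐besselTerm {k} k≤d =
    subst (λ u → (coeffB d k ℚ.* (x ^ℚ k)) · u ≐ besselTerm d N k) (sym (^-distrib-*ℤ (ℤ.+ 2) (ℤ.+ suc Q-1) k))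
      (·≐-* (coeffB·2^k≐intCoeff k≤d) (·≐-^ k (mkℚ·denominator≐numerator N Q-1 coprime)))

  evalUpTo·T^j≐horner : ∀ {j} → j ≤ d → evalUpTo d j x · T ℤ.^ j ≐ horner (besselTerm d N) T j
  evalUpTo·T^j≐horner {zero}  j≤d = besselMonomial·T^k≐besselTerm j≤d
  evalUpTo·T^j≐horner {suc j} j≤d =
    ·≐-+ (·≐-*ˡ T (evalUpTo·T^j≐horner (≤-trans (n≤1+n j) j≤d))) (besselMonomial·T^k≐besselTerm j≤d)

  evalB≡0⇒horner≡0 : evalB d x ≡ 0ℚ → horner (besselTerm d N) T d ≡ 0ℤ
  evalB≡0⇒horner≡0 evalB≡0 = ·≐-zero evalB≡0 (evalUpTo·T^j≐horner ≤-refl)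

∣horner-leadingTerm : ∀ {P} t T j → (∀ {k} → 1 ≤ k → k ≤ j → P ∣ℤ t k) →
                      P ∣ℤ horner t T j ℤ.- T ℤ.^ j ℤ.* t 0
∣horner-leadingTerm {P} t T zero    _     = ℤ∣.divides (0ℤ) (no-lower-terms (t 0) P)
  where
  no-lower-terms : ∀ a P → a ℤ.- 1ℤ ℤ.* a ≡ (0ℤ) ℤ.* P
  no-lower-terms = ℤ-Solver.solve-∀
∣horner-leadingTerm {P} t T (suc j) P∣t =
  subst (P ∣ℤ_) (factor-T (horner t T j) T (T ℤ.^ j) (t 0) (t (suc j)))
    (ℤ∣.∣m∣n⇒∣m+n (ℤ∣.∣n⇒∣m*n T (∣horner-leadingTerm t T j λ 1≤k k≤j → P∣t 1≤k (m≤n⇒m≤1+n k≤j)))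
                  (P∣t (s≤s z≤n) ≤-refl))
  where
  factor-T : ∀ h T Tʲ t₀ a → T ℤ.* (h ℤ.- Tʲ ℤ.* t₀) ℤ.+ a ≡ (T ℤ.* h ℤ.+ a) ℤ.- (T ℤ.* Tʲ) ℤ.* t₀
  factor-T = ℤ-Solver.solve-∀

∣horner⇒∣top : ∀ {P} t T j → (∀ {k} → k < j → P ∣ℤ T ℤ.^ (j ∸ k) ℤ.* t k) →
               P ∣ℤ horner t T j → P ∣ℤ t j
∣horner⇒∣top         t T zero    _     P∣h = P∣h
∣horner⇒∣top {P} t T (suc j) P∣lower P∣h =
  subst (P ∣ℤ_) (cancel (horner t T j) T (t (suc j)))
    (ℤ∣.∣m∣n⇒∣m-n P∣h (subst (λ e → P ∣ℤ T ℤ.^ e ℤ.* horner t T j) 1+j∸j≡1 (∣prefix j ≤-refl)))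
  where
  cancel : ∀ h T a → T ℤ.* h ℤ.+ a ℤ.- T ℤ.* 1ℤ ℤ.* h ≡ a
  cancel = ℤ-Solver.solve-∀
  1+j∸j≡1 : suc j ∸ j ≡ 1
  1+j∸j≡1 = trans (+-∸-assoc 1 (≤-refl {j})) (cong suc (n∸n≡0 j))
  ∣prefix : ∀ i → i ≤ j → P ∣ℤ T ℤ.^ (suc j ∸ i) ℤ.* horner t T i
  ∣prefix zero    _   = P∣lower (s≤s z≤n)
  ∣prefix (suc i) i<j =
    subst (P ∣ℤ_) (distribute (T ℤ.^ (j ∸ i)) T (horner t T i) (t (suc i)))
      (ℤ∣.∣m∣n⇒∣m+n (subst (λ e → P ∣ℤ T ℤ.^ e ℤ.* horner t T i) (+-∸-assoc 1 (<⇒≤ i<j))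
                                   (∣prefix i (<⇒≤ i<j)))
                    (P∣lower (s≤s i<j)))
    where
    distribute : ∀ Tᵉ T h a → (T ℤ.* Tᵉ) ℤ.* h ℤ.+ Tᵉ ℤ.* a ≡ Tᵉ ℤ.* (T ℤ.* h ℤ.+ a)
    distribute = ℤ-Solver.solve-∀

m^e∣m^f : ∀ m {e f} → e ≤ f → m ^ e ∣ m ^ f
m^e∣m^f m {e} {f} e≤f = divides (m ^ (f ∸ e)) (begin
  m ^ f             ≡⟨ cong (m ^_) (m∸n+n≡m e≤f) ⟨
  m ^ (f ∸ e + e)   ≡⟨ ^-distribˡ-+-* m (f ∸ e) e ⟩
  m ^ (f ∸ e) * m ^ e ∎)
  where open ≡-Reasoning

^-monoˡ-∣ : ∀ {m n} k → m ∣ n → m ^ k ∣ n ^ k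
^-monoˡ-∣ zero    _   = ∣-refl
^-monoˡ-∣ (suc k) m∣n = *-pres-∣ m∣n (^-monoˡ-∣ k m∣n)

^-distrib-* : ∀ a b n → (a * b) ^ n ≡ a ^ n * b ^ n
^-distrib-* a b zero    = refl
^-distrib-* a b (suc n) = trans (cong (a * b *_) (^-distrib-* a b n)) (*-interchange a b (a ^ n) (b ^ n))

sum-below : ∀ r {V m x y} → suc r * x < m → suc r * y < suc r + V * r → V < m → x + y < m
sum-below r {V} {m} {x} {y} [r+1]x<m [r+1]y<r+1+Vr V<m =
  *-cancelˡ-< (suc r) (x + y) m (+-cancelʳ-≤ 1 _ _ (begin
    suc (suc r * (x + y)) + 1         ≡⟨ split-+1 (suc r) x y ⟩
    suc (suc r * x) + suc (suc r * y) ≤⟨ +-mono-≤ [r+1]x<m [r+1]y<r+1+Vr ⟩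
    m + (suc r + V * r)               ≡⟨ regroup m r V ⟩
    m + 1 + suc V * r                 ≤⟨ +-monoʳ-≤ (m + 1) (*-monoˡ-≤ r V<m) ⟩
    m + 1 + m * r                     ≡⟨ collect m r ⟩
    suc r * m + 1                     ∎))
  where
  open ≤-Reasoning
  split-+1 : ∀ a x y → suc (a * (x + y)) + 1 ≡ suc (a * x) + suc (a * y)
  split-+1 = solve-∀
  regroup : ∀ m r V → m + (suc r + V * r) ≡ m + 1 + suc V * r
  regroup = solve-∀
  collect : ∀ m r → m + 1 + m * r ≡ suc r * m + 1
  collect = solve-∀

module Valuation {p : ℕ} (p-prime : Prime p) where

  1<p : 1 < p
  1<p = nonTrivial⇒n>1 p {{prime⇒nonTrivial p-prime}}

  instance
    p≢0 : NonZero p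
    p≢0 = >-nonZero (<-trans z<s 1<p)

  p∤1 : ¬ p ∣ 1
  p∤1 p∣1 = <-irrefl (sym (∣1⇒≡1 p∣1)) 1<p

  ∣^⇒∣ : ∀ {b} m → p ∣ b ^ m → p ∣ b
  ∣^⇒∣     zero    p∣1   = ⊥-elim (p∤1 p∣1)
  ∣^⇒∣ {b} (suc m) p∣b^m = [ (λ p∣b → p∣b) , ∣^⇒∣ m ]′ (euclidsLemma b (b ^ m) p-prime p∣b^m)

  infix 4 v[_]≡_

  record v[_]≡_ (n e : ℕ) : Set where
    constructor valuation
    field
      pᵉ∣n   : p ^ e ∣ n
      pᵉ⁺¹∤n : ¬ p ^ suc e ∣ n

  open v[_]≡_ public

  v-intro : ∀ {a} e → ¬ p ∣ a → v[ a * p ^ e ]≡ e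
  v-intro {a} e p∤a = valuation (n∣m*n a) λ pᵉ⁺¹∣ → p∤a (*-cancelʳ-∣ (p ^ e) {{m^n≢0 p e}} pᵉ⁺¹∣)

  v-elim : ∀ {n e} → v[ n ]≡ e → ∃ λ a → ¬ p ∣ a × n ≡ a * p ^ e
  v-elim {n} {e} (valuation (divides a n≡a*pᵉ) pᵉ⁺¹∤n) = a , p∤a , n≡a*pᵉ
    where
    p∤a : ¬ p ∣ a
    p∤a (divides c refl) = pᵉ⁺¹∤n (divides c (trans n≡a*pᵉ (*-assoc c p (p ^ e))))

  v-* : ∀ {m n e f} → v[ m ]≡ e → v[ n ]≡ f → v[ m * n ]≡ e + f
  v-* {m} {n} {e} {f} vm vn with v-elim vm | v-elim vn
  ... | a , p∤a , refl | b , p∤b , refl =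
    subst (v[_]≡ e + f)
      (trans (cong (a * b *_) (^-distribˡ-+-* p e f)) (*-interchange a b (p ^ e) (p ^ f)))
      (v-intro (e + f) ([ p∤a , p∤b ]′ ∘ euclidsLemma a b p-prime))

  v-unique : ∀ {n e f} → v[ n ]≡ e → v[ n ]≡ f → e ≡ f
  v-unique {e = e} {f} ve vf with <-cmp e f
  ... | tri< e<f _ _ = ⊥-elim (pᵉ⁺¹∤n ve (∣-trans (m^e∣m^f p e<f) (pᵉ∣n vf)))
  ... | tri≈ _ e≡f _ = e≡f
  ... | tri> _ _ f<e = ⊥-elim (pᵉ⁺¹∤n vf (∣-trans (m^e∣m^f p f<e) (pᵉ∣n ve)))

  v-coprime : ∀ {n} → ¬ p ∣ n → v[ n ]≡ 0
  v-coprime {n} p∤n = subst (v[_]≡ 0) (*-identityʳ n) (v-intro 0 p∤n)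

  v-pow : ∀ e → v[ p ^ e ]≡ e
  v-pow e = subst (v[_]≡ e) (*-identityˡ (p ^ e)) (v-intro e p∤1)

  v-^-coprime : ∀ {n} k → ¬ p ∣ n → v[ n ^ k ]≡ 0
  v-^-coprime zero    p∤n = v-coprime p∤1
  v-^-coprime (suc k) p∤n = v-* (v-coprime p∤n) (v-^-coprime k p∤n)

  v[p]≡1 : v[ p ]≡ 1
  v[p]≡1 = subst (v[_]≡ 1) (*-identityʳ p) (v-pow 1)

  v-exists : ∀ n → .{{NonZero n}} → ∃ (v[ n ]≡_)
  v-exists = <-rec (λ n → .{{NonZero n}} → ∃ (v[ n ]≡_)) step
    where
    step : ∀ n → (∀ {m} → m < n → .{{NonZero m}} → ∃ (v[ m ]≡_)) → .{{NonZero n}} → ∃ (v[ n ]≡_)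
    step n rec with p ∣? n
    ... | no  p∤n              = 0 , v-coprime p∤n
    ... | yes (divides c refl) = suc e , subst (v[ c * p ]≡_) (+-comm e 1) (v-* vc v[p]≡1)
      where
      instance
        c≢0 : NonZero c
        c≢0 = m*n≢0⇒m≢0 c
      e = proj₁ (rec (m<m*n c p 1<p))
      vc = proj₂ (rec (m<m*n c p 1<p))

module Legendre {p : ℕ} (1<p : 1 < p) where

  instance
    p≢0 : NonZero p
    p≢0 = >-nonZero (<-trans z<s 1<p)

  0/p≡0 : 0 / p ≡ 0
  0/p≡0 = 0/n≡0 p

  digits : ∀ n → ∃ λ q → ∃ λ r → r < p × n ≡ r + q * p
  digits n = n / p , n % p , m%n<n n p , m≡m%n+[m/n]*n n p

  [r+q*p]/p≡q : ∀ q {r} → r < p → (r + q * p) / p ≡ q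
  [r+q*p]/p≡q q {r} r<p = trans (+-distrib-/-∣ʳ r (n∣m*n q)) (cong₂ _+_ (m<n⇒m/n≡0 r<p) (m*n/n≡m q p))

  digit-induction : (P : ℕ → Set) → P 0 → (∀ q r → r < p → P q → P (r + q * p)) → ∀ n → P n
  digit-induction P P0 step = <-rec P go
    where
    go : ∀ n → (∀ {m} → m < n → P m) → P n
    go zero      _   = P0
    go n@(suc _) rec = subst P (sym (m≡m%n+[m/n]*n n p))
      (step (n / p) (n % p) (m%n<n n p) (rec (m/n<m n p 1<p)))

  -- legendreWithFuel f n = Σ_{1 ≤ i ≤ f} ⌊n / pⁱ⌋; fuel n is enough, as ⌊n / pⁱ⌋ = 0 for i > n.
  private
    legendreWithFuel : ℕ → ℕ → ℕ
    legendreWithFuel zero    n = 0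
    legendreWithFuel (suc f) n = n / p + legendreWithFuel f (n / p)

    fuel-0 : ∀ f → legendreWithFuel f 0 ≡ 0
    fuel-0 zero    = refl
    fuel-0 (suc f) rewrite 0/p≡0 = fuel-0 f

    /p-≤-pred : ∀ {n} f → n ≤ suc f → n / p ≤ f
    /p-≤-pred {zero}  f _           rewrite 0/p≡0 = z≤n
    /p-≤-pred {suc n} f (s≤s n≤f) = <⇒≤pred (<-≤-trans (m/n<m (suc n) p 1<p) (s≤s n≤f))

    fuel-irrelevant : ∀ f g {n} → n ≤ f → n ≤ g → legendreWithFuel f n ≡ legendreWithFuel g n
    fuel-irrelevant zero    g       z≤n _   = sym (fuel-0 g)
    fuel-irrelevant (suc f) zero    _   z≤n = fuel-0 (suc f)
    fuel-irrelevant (suc f) (suc g) {n} n≤f n≤g =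
      cong (λ l → n / p + l) (fuel-irrelevant f g (/p-≤-pred f n≤f) (/p-≤-pred g n≤g))

  legendre : ℕ → ℕ
  legendre n = legendreWithFuel n n

  legendre-unfold : ∀ n → legendre n ≡ n / p + legendre (n / p)
  legendre-unfold zero    rewrite 0/p≡0 = refl
  legendre-unfold (suc n) =
    cong (λ l → suc n / p + l) (fuel-irrelevant n (suc n / p) (/p-≤-pred n ≤-refl) ≤-refl)

  legendre-digits : ∀ q {r} → r < p → legendre (r + q * p) ≡ q + legendre q
  legendre-digits q {r} r<p =
    trans (legendre-unfold (r + q * p)) (cong (λ n → n + legendre n) ([r+q*p]/p≡q q r<p))

  legendre-small : ∀ {r} → r < p → legendre r ≡ 0
  legendre-small {r} r<p = trans (cong legendre (sym (+-identityʳ r))) (legendre-digits 0 r<p)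

  ∣r+q*p⇒r≡0 : ∀ q {r} → r < p → p ∣ r + q * p → r ≡ 0
  ∣r+q*p⇒r≡0 q {zero}  _   _ = refl
  ∣r+q*p⇒r≡0 q {suc r} r<p p∣ =
    ⊥-elim (>⇒∤ r<p (∣m+n∣m⇒∣n (subst (p ∣_) (+-comm (suc r) (q * p)) p∣) (n∣m*n q)))

  legendre-suc : ∀ {n} → ¬ p ∣ suc n → legendre (suc n) ≡ legendre n
  legendre-suc {n} p∤1+n with digits n
  ... | q , r , r<p , refl with m≤n⇒m<n∨m≡n r<p
  ... | inj₁ 1+r<p = trans (legendre-digits q 1+r<p) (sym (legendre-digits q r<p))
  ... | inj₂ 1+r≡p = ⊥-elim (p∤1+n (divides (suc q) (cong (_+ q * p) 1+r≡p)))

  [p∸1]*legendre< : ∀ {m} → 1 ≤ m → (p ∸ 1) * legendre m < m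
  [p∸1]*legendre< = digit-induction (λ m → 1 ≤ m → (p ∸ 1) * legendre m < m) (λ ()) step _
    where
    step : ∀ q r → r < p → (1 ≤ q → (p ∸ 1) * legendre q < q) →
           1 ≤ r + q * p → (p ∸ 1) * legendre (r + q * p) < r + q * p
    step zero    r r<p _  1≤r rewrite legendre-digits 0 r<p | *-zeroʳ (p ∸ 1) = 1≤r
    step (suc q) r r<p ih _   rewrite legendre-digits (suc q) r<p = begin-strict
      (p ∸ 1) * (suc q + legendre (suc q))           ≡⟨ *-distribˡ-+ (p ∸ 1) (suc q) _ ⟩
      (p ∸ 1) * suc q + (p ∸ 1) * legendre (suc q)   <⟨ +-monoʳ-< ((p ∸ 1) * suc q) (ih (s≤s z≤n)) ⟩
      (p ∸ 1) * suc q + suc q                        ≡⟨ +-comm _ (suc q) ⟩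
      (1 + (p ∸ 1)) * suc q                          ≡⟨ cong (_* suc q) (m+[n∸m]≡n (<⇒≤ 1<p)) ⟩
      p * suc q                                      ≡⟨ *-comm p (suc q) ⟩
      suc q * p                                      ≤⟨ m≤n+m (suc q * p) r ⟩
      r + suc q * p                                  ∎
      where open ≤-Reasoning

  legendre< : ∀ {m} → 1 ≤ m → legendre m < m
  legendre< 1≤m = ≤-<-trans (m≤n*m _ (p ∸ 1) {{>-nonZero (m<n⇒0<n∸m 1<p)}}) ([p∸1]*legendre< 1≤m)

  add-with-carry : ∀ {ra rb c} → ra < p → rb < p → c ≤ 1 →
                   ∃ λ r → ∃ λ c′ → r < p × c′ ≤ 1 × ra + rb + c ≡ r + c′ * p
  add-with-carry {ra} {rb} {c} ra<p rb<p c≤1 with ra + rb + c <? p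
  ... | yes s<p = ra + rb + c , 0 , s<p , z≤n , sym (+-identityʳ _)
  ... | no  s≮p = ra + rb + c ∸ p , 1 , m<n+o⇒m∸n<o _ p s<p+p , ≤-refl ,
                  sym (trans (cong (ra + rb + c ∸ p +_) (+-identityʳ p)) (m∸n+n≡m (≮⇒≥ s≮p)))
    where
    s<p+p : ra + rb + c < p + p
    s<p+p = begin-strict
      ra + rb + c   ≤⟨ +-monoʳ-≤ (ra + rb) c≤1 ⟩
      ra + rb + 1   ≡⟨ +-comm (ra + rb) 1 ⟩
      suc ra + rb   ≤⟨ +-monoˡ-≤ rb ra<p ⟩
      p + rb        <⟨ +-monoʳ-< p rb<p ⟩
      p + p         ∎
      where open ≤-Reasoning

  add-digits : ∀ qa qb {ra rb c} → ra < p → rb < p → c ≤ 1 →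
               ∃ λ c′ → ∃ λ r → c′ ≤ 1 × r < p × ra + qa * p + (rb + qb * p) + c ≡ r + (qa + qb + c′) * p
  add-digits qa qb {ra} {rb} {c} ra<p rb<p c≤1 with add-with-carry ra<p rb<p c≤1
  ... | r , c′ , r<p , c′≤1 , carry = c′ , r , c′≤1 , r<p , (begin
    ra + qa * p + (rb + qb * p) + c  ≡⟨ regroup ra qa rb qb c p ⟩
    (ra + rb + c) + (qa + qb) * p    ≡⟨ cong (_+ (qa + qb) * p) carry ⟩
    r + c′ * p + (qa + qb) * p       ≡⟨ collect r c′ qa qb p ⟩
    r + (qa + qb + c′) * p           ∎)
    where
    open ≡-Reasoning
    regroup : ∀ ra qa rb qb c p → ra + qa * p + (rb + qb * p) + c ≡ (ra + rb + c) + (qa + qb) * p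
    regroup = solve-∀
    collect : ∀ r c′ qa qb p → r + c′ * p + (qa + qb) * p ≡ r + (qa + qb + c′) * p
    collect = solve-∀

  r+q*p<p*x⇒q<x : ∀ {r q x} → r + q * p < p * x → q < x
  r+q*p<p*x⇒q<x {r} {q} {x} r+q*p<p*x =
    *-cancelʳ-< p q x (≤-<-trans (m≤n+m (q * p) r) (subst (r + q * p <_) (*-comm p x) r+q*p<p*x))

  <p^n : ∀ n → n < p ^ n
  <p^n zero    = z<s
  <p^n (suc n) = ≤-<-trans (<p^n n) (subst (p ^ n <_) (*-comm (p ^ n) p) (m<m*n (p ^ n) p 1<p))
    where instance _ = m^n≢0 p n

  ⌊log⌋-exists : ∀ n → .{{NonZero n}} → ∃ λ ℓ → p ^ ℓ ≤ n × n < p ^ suc ℓ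
  ⌊log⌋-exists 1 = 0 , ≤-refl , subst (1 <_) (sym (*-identityʳ p)) 1<p
  ⌊log⌋-exists (suc n@(suc _)) with ⌊log⌋-exists n
  ... | ℓ , pˡ≤n , n<pˡ⁺¹ with suc n <? p ^ suc ℓ
  ... | yes 1+n<pˡ⁺¹ = ℓ , m≤n⇒m≤1+n pˡ≤n , 1+n<pˡ⁺¹
  ... | no  1+n≮pˡ⁺¹ = suc ℓ , ≮⇒≥ 1+n≮pˡ⁺¹ ,
        subst (_< p ^ suc (suc ℓ)) (≤-antisym (≮⇒≥ 1+n≮pˡ⁺¹) n<pˡ⁺¹) (^-monoʳ-< p 1<p (n<1+n (suc ℓ)))

  -- legendre (a + b + c) − legendre a − legendre b counts the carries when adding a, b and an
  -- incoming carry c; below p ^ (ℓ + 1) there are at most ℓ of them.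
  legendre-+-bounds : ∀ ℓ {a b c} → c ≤ 1 → a + b + c < p ^ suc ℓ →
                      legendre a + legendre b ≤ legendre (a + b + c) ×
                      legendre (a + b + c) ≤ legendre a + legendre b + ℓ
  legendre-+-bounds zero {a} {b} {c} _ s<p*1 =
    ≤-trans (≤-reflexive (cong₂ _+_ (small (≤-trans (m≤m+n a b) (m≤m+n _ c)))
                                    (small (≤-trans (m≤n+m b a) (m≤m+n _ c))))) z≤n ,
    ≤-trans (≤-reflexive (small ≤-refl)) z≤n
    where
    small : ∀ {x} → x ≤ a + b + c → legendre x ≡ 0
    small x≤s = legendre-small (≤-<-trans x≤s (subst (_ <_) (*-identityʳ p) s<p*1))
  legendre-+-bounds (suc ℓ) {a} {b} {c} c≤1 s<pˡ⁺² with digits a | digits b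
  ... | qa , ra , ra<p , refl | qb , rb , rb<p , refl with add-digits qa qb ra<p rb<p c≤1
  ... | c′ , r , c′≤1 , r<p , sum-digits = lower , upper
    where
    open ≤-Reasoning
    Q = qa + qb + c′
    ih = legendre-+-bounds ℓ {qa} {qb} c′≤1 (r+q*p<p*x⇒q<x (subst (_< p ^ suc (suc ℓ)) sum-digits s<pˡ⁺²))
    legendre-sum : legendre (ra + qa * p + (rb + qb * p) + c) ≡ Q + legendre Q
    legendre-sum = trans (cong legendre sum-digits) (legendre-digits Q r<p)
    lower = begin
      legendre (ra + qa * p) + legendre (rb + qb * p) ≡⟨ cong₂ _+_ (legendre-digits qa ra<p) (legendre-digits qb rb<p) ⟩
      qa + legendre qa + (qb + legendre qb)           ≡⟨ +-interchange qa (legendre qa) qb (legendre qb) ⟩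
      (qa + qb) + (legendre qa + legendre qb)         ≤⟨ +-mono-≤ (m≤m+n (qa + qb) c′) (proj₁ ih) ⟩
      Q + legendre Q                                  ≡⟨ legendre-sum ⟨
      legendre (ra + qa * p + (rb + qb * p) + c)      ∎
    upper = begin
      legendre (ra + qa * p + (rb + qb * p) + c)           ≡⟨ legendre-sum ⟩
      Q + legendre Q                                       ≤⟨ +-mono-≤ (+-monoʳ-≤ (qa + qb) c′≤1) (proj₂ ih) ⟩
      (qa + qb + 1) + (legendre qa + legendre qb + ℓ)      ≡⟨ regroup qa qb (legendre qa) (legendre qb) ℓ ⟩
      (qa + legendre qa) + (qb + legendre qb) + suc ℓ
        ≡⟨ cong₂ (λ x y → x + y + suc ℓ) (legendre-digits qa ra<p) (legendre-digits qb rb<p) ⟨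
      legendre (ra + qa * p) + legendre (rb + qb * p) + suc ℓ ∎
      where
      regroup : ∀ a b c d e → (a + b + 1) + (c + d + e) ≡ (a + c) + (b + d) + suc e
      regroup = solve-∀

  legendre-superadditive : ∀ a b → legendre a + legendre b ≤ legendre (a + b)
  legendre-superadditive a b = subst (λ n → legendre a + legendre b ≤ legendre n) (+-identityʳ (a + b))
    (proj₁ (legendre-+-bounds (a + b) {a} {b} z≤n
      (≤-<-trans (≤-reflexive (+-identityʳ (a + b))) (<-trans (n<1+n (a + b)) (<p^n (suc (a + b)))))))

  legendre-+-≤ : ∀ ℓ {a b} → a + b < p ^ suc ℓ → legendre (a + b) ≤ legendre a + legendre b + ℓ
  legendre-+-≤ ℓ {a} {b} a+b<pˡ⁺¹ = subst (λ n → legendre n ≤ legendre a + legendre b + ℓ) (+-identityʳ (a + b))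
    (proj₂ (legendre-+-bounds ℓ {a} {b} z≤n (≤-<-trans (≤-reflexive (+-identityʳ (a + b))) a+b<pˡ⁺¹)))

  round-up : ∀ m₀ → ∃ λ k → ∃ λ s → s < p × suc m₀ + s ≡ suc k * p
  round-up m₀ with digits m₀
  ... | k , s′ , s′<p , refl = k , p ∸ suc s′ , ∸-monoʳ-< z<s s′<p , (begin
    suc (s′ + k * p) + (p ∸ suc s′)   ≡⟨ +-right-comm (suc s′) (k * p) (p ∸ suc s′) ⟩
    suc s′ + (p ∸ suc s′) + k * p     ≡⟨ cong (_+ k * p) (m+[n∸m]≡n s′<p) ⟩
    p + k * p                         ∎)
    where open ≡-Reasoning

  round-up-≤ : ∀ {m s m′ B} → m ≤ B * p → s < p → m + s ≡ m′ * p → m′ ≤ B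
  round-up-≤ {m} {s} {m′} {B} m≤B*p s<p m+s≡m′*p = s≤s⁻¹ (*-cancelʳ-< p m′ (suc B)
    (subst₂ _<_ m+s≡m′*p (+-comm (B * p) p) (+-mono-≤-< m≤B*p s<p)))

  round-up-level : ∀ v {q m s m′} → p ^ v ∣ q * p → m ≤ p ^ v → s < p → m + s ≡ m′ * p →
                   ∃ λ w → p ^ w ∣ q × m′ ≤ p ^ w
  round-up-level zero    {q} _ m≤1 s<p m+s≡m′*p =
    0 , 1∣ q , round-up-≤ (≤-trans m≤1 (≤-trans (<⇒≤ 1<p) (≤-reflexive (sym (*-identityˡ p))))) s<p m+s≡m′*p
  round-up-level (suc w) {q} {m} pʷ⁺¹∣q*p m≤pʷ⁺¹ s<p m+s≡m′*p =
    w , *-cancelʳ-∣ p (subst (_∣ q * p) (*-comm p (p ^ w)) pʷ⁺¹∣q*p) ,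
    round-up-≤ (subst (m ≤_) (*-comm p (p ^ w)) m≤pʷ⁺¹) s<p m+s≡m′*p

  complement-digits : ∀ {q m c s m′} → q * p ≡ m + c → m + s ≡ m′ * p → m′ ≤ q → c ≡ s + (q ∸ m′) * p
  complement-digits {q} {m} {c} {s} {m′} q*p≡m+c m+s≡m′*p m′≤q = +-cancelˡ-≡ m c (s + (q ∸ m′) * p) (begin
    m + c                       ≡⟨ q*p≡m+c ⟨
    q * p                       ≡⟨ cong (_* p) (m+[n∸m]≡n m′≤q) ⟨
    (m′ + (q ∸ m′)) * p         ≡⟨ *-distribʳ-+ p m′ (q ∸ m′) ⟩
    m′ * p + (q ∸ m′) * p       ≡⟨ cong (_+ (q ∸ m′) * p) m+s≡m′*p ⟨
    m + s + (q ∸ m′) * p        ≡⟨ +-assoc m s ((q ∸ m′) * p) ⟩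
    m + (s + (q ∸ m′) * p)      ∎)
    where open ≡-Reasoning

module LegendreFormula {p : ℕ} (p-prime : Prime p) where

  open Valuation p-prime
  open Legendre 1<p hiding (p≢0)

  legendre-suc≡+v : ∀ {n e} → v[ suc n ]≡ e → legendre (suc n) ≡ legendre n + e
  legendre-suc≡+v {n} = <-rec (λ n → ∀ {e} → v[ suc n ]≡ e → legendre (suc n) ≡ legendre n + e) step n
    where
    step : ∀ n → (∀ {m} → m < n → ∀ {e} → v[ suc m ]≡ e → legendre (suc m) ≡ legendre m + e) →
           ∀ {e} → v[ suc n ]≡ e → legendre (suc n) ≡ legendre n + e
    step n rec {e} v[1+n] with digits n
    ... | q , r , r<p , refl with m≤n⇒m<n∨m≡n r<p
    ... | inj₁ 1+r<p = begin
      legendre (suc r + q * p)   ≡⟨ legendre-digits q 1+r<p ⟩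
      q + legendre q             ≡⟨ legendre-digits q r<p ⟨
      legendre (r + q * p)       ≡⟨ +-identityʳ _ ⟨
      legendre (r + q * p) + 0   ≡⟨ cong (legendre (r + q * p) +_) (v-unique (v-coprime p∤1+n) v[1+n]) ⟩
      legendre (r + q * p) + e   ∎
      where
      open ≡-Reasoning
      p∤1+n : ¬ p ∣ suc r + q * p
      p∤1+n p∣ with () ← ∣r+q*p⇒r≡0 q 1+r<p p∣
    ... | inj₂ 1+r≡p with v-exists (suc q)
    ... | e′ , v[1+q] = begin
      legendre (suc r + q * p)         ≡⟨ cong legendre 1+n≡[1+q]*p ⟩
      legendre (0 + suc q * p)         ≡⟨ legendre-digits (suc q) (<-trans z<s 1<p) ⟩
      suc q + legendre (suc q)         ≡⟨ cong (suc q +_) (rec q<n v[1+q]) ⟩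
      suc q + (legendre q + e′)        ≡⟨ regroup q (legendre q) e′ ⟩
      q + legendre q + suc e′          ≡⟨ cong₂ _+_ (sym (legendre-digits q r<p)) e′+1≡e ⟩
      legendre (r + q * p) + e         ∎
      where
      open ≡-Reasoning
      1+n≡[1+q]*p : suc r + q * p ≡ 0 + suc q * p
      1+n≡[1+q]*p = cong (_+ q * p) 1+r≡p
      e′+1≡e : suc e′ ≡ e
      e′+1≡e = v-unique (subst (v[_]≡ suc e′) (sym 1+n≡[1+q]*p)
                          (subst (v[ suc q * p ]≡_) (+-comm e′ 1) (v-* v[1+q] v[p]≡1)))
                        v[1+n]
      1≤r : 1 ≤ r
      1≤r = s≤s⁻¹ (subst (1 <_) (sym 1+r≡p) 1<p)
      q<n : q < r + q * p
      q<n = <-≤-trans (s≤s (m≤m*n q p)) (+-monoˡ-≤ (q * p) 1≤r)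
      regroup : ∀ q l e → suc q + (l + e) ≡ q + l + suc e
      regroup = solve-∀

  v[n!]≡legendre : ∀ n → v[ n ! ]≡ legendre n
  v[n!]≡legendre zero    = v-coprime p∤1
  v[n!]≡legendre (suc n) with v-exists (suc n)
  ... | e , v[1+n] = subst (v[ suc n ! ]≡_) (trans (+-comm e _) (sym (legendre-suc≡+v v[1+n])))
                       (v-* v[1+n] (v[n!]≡legendre n))

  v[intCoeff] : ∀ {d k e} → k ≤ d → v[ intCoeff d k ]≡ e → e + (legendre k + legendre (d ∸ k)) ≡ legendre (d + k)
  v[intCoeff] {d} {k} {e} k≤d v[a] = v-unique
    (subst (v[_]≡ e + (legendre k + legendre (d ∸ k))) (intCoeff-spec k≤d)
      (v-* v[a] (v-* (v[n!]≡legendre k) (v[n!]≡legendre (d ∸ k)))))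
    (v[n!]≡legendre (d + k))

module OddPrime {p : ℕ} (p-prime : Prime p) (p∤2 : ¬ p ∣ 2) where

  open Valuation p-prime
  open Legendre 1<p hiding (p≢0)
  open LegendreFormula p-prime

  -- v_p (2b choose b) = v_p (b + c choose b), by Legendre's formula
  DoubleIdentity : ℕ → Set
  DoubleIdentity b = ∀ v {m c} → p ^ v ∣ b → b ≡ m + c → 1 ≤ m → m ≤ p ^ v →
                     legendre (b + b) + legendre c ≡ legendre (b + c) + legendre b

  double-identity-coprime : ∀ {b} → ¬ p ∣ b → DoubleIdentity b
  double-identity-coprime {b} p∤b zero    {m} {c} _ b≡m+c 1≤m m≤1 = begin
    legendre (b + b) + legendre c       ≡⟨ cong (λ n → legendre n + legendre c) b+b≡1+b+c ⟩
    legendre (suc (b + c)) + legendre c ≡⟨ cong₂ _+_ (legendre-suc p∤1+b+c) (sym (legendre-suc p∤1+c)) ⟩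
    legendre (b + c) + legendre (suc c) ≡⟨ cong (λ n → legendre (b + c) + legendre n) b≡1+c ⟨
    legendre (b + c) + legendre b       ∎
    where
    open ≡-Reasoning
    b≡1+c : b ≡ suc c
    b≡1+c = trans b≡m+c (cong (_+ c) (≤-antisym m≤1 1≤m))
    b+b≡1+b+c : b + b ≡ suc (b + c)
    b+b≡1+b+c = trans (cong (b +_) b≡1+c) (+-suc b c)
    p∤1+c : ¬ p ∣ suc c
    p∤1+c = subst (λ n → ¬ p ∣ n) b≡1+c p∤b
    p∤1+b+c : ¬ p ∣ suc (b + c)
    p∤1+b+c p∣ = [ p∤2 , p∤b ]′ (euclidsLemma 2 b p-prime
      (subst (p ∣_) (trans (sym b+b≡1+b+c) (cong (b +_) (sym (+-identityʳ b)))) p∣))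
  double-identity-coprime p∤b (suc v) pᵛ∣b = ⊥-elim (p∤b (∣-trans (m∣m*n (p ^ v)) pᵛ∣b))

  double-identity-multiple : ∀ {q} → DoubleIdentity q → DoubleIdentity (0 + q * p)
  double-identity-multiple         ih v {zero}          _    _     ()
  double-identity-multiple {q} ih v {m@(suc m₀)} {c} pᵛ∣b b≡m+c _ m≤pᵛ with round-up m₀
  ... | k , s , s<p , m+s≡m′*p with round-up-level v pᵛ∣b m≤pᵛ s<p m+s≡m′*p
  ... | w , pʷ∣q , m′≤pʷ = begin
    legendre (b + b) + legendre c                    ≡⟨ cong₂ _+_ legendre-b+b legendre-c ⟩
    (q + q) + legendre (q + q) + (c′ + legendre c′)  ≡⟨ +-interchange (q + q) _ c′ _ ⟩
    (q + q + c′) + (legendre (q + q) + legendre c′)  ≡⟨ cong ((q + q + c′) +_) (ih w pʷ∣q q≡m′+c′ (s≤s z≤n) m′≤pʷ) ⟩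
    (q + q + c′) + (legendre (q + c′) + legendre q)  ≡⟨ regroup q c′ (legendre (q + c′)) (legendre q) ⟩
    (q + c′) + legendre (q + c′) + (q + legendre q)  ≡⟨ cong₂ _+_ legendre-b+c (legendre-digits q (<-trans z<s 1<p)) ⟨
    legendre (b + c) + legendre b                    ∎
    where
    open ≡-Reasoning
    b = 0 + q * p
    m′≤q : suc k ≤ q
    m′≤q = round-up-≤ (subst (m ≤_) (sym b≡m+c) (m≤m+n m c)) s<p m+s≡m′*p
    c′ = q ∸ suc k
    q≡m′+c′ : q ≡ suc k + c′
    q≡m′+c′ = sym (m+[n∸m]≡n m′≤q)
    c≡s+c′*p : c ≡ s + c′ * p
    c≡s+c′*p = complement-digits b≡m+c m+s≡m′*p m′≤q
    legendre-b+b : legendre (b + b) ≡ (q + q) + legendre (q + q)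
    legendre-b+b = trans (cong legendre (sym (*-distribʳ-+ p q q))) (legendre-digits (q + q) (<-trans z<s 1<p))
    legendre-c : legendre c ≡ c′ + legendre c′
    legendre-c = trans (cong legendre c≡s+c′*p) (legendre-digits c′ s<p)
    b+c≡s+[q+c′]*p : b + c ≡ s + (q + c′) * p
    b+c≡s+[q+c′]*p = trans (cong (q * p +_) c≡s+c′*p)
      (trans (+-left-comm (q * p) s (c′ * p)) (cong (s +_) (sym (*-distribʳ-+ p q c′))))
    legendre-b+c : legendre (b + c) ≡ (q + c′) + legendre (q + c′)
    legendre-b+c = trans (cong legendre b+c≡s+[q+c′]*p) (legendre-digits (q + c′) s<p)
    regroup : ∀ q c a b → (q + q + c) + (a + b) ≡ (q + c) + a + (q + b)
    regroup = solve-∀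

  -- Kummer: b ends in at least v zero digits and 1 ≤ b − c ≤ pᵛ, so b + b and b + c carry alike.
  legendre-double≡ : ∀ b → DoubleIdentity b
  legendre-double≡ = digit-induction DoubleIdentity base step
    where
    base : DoubleIdentity 0
    base v {zero}  _ _  ()
    base v {suc m} _ ()
    step : ∀ q r → r < p → DoubleIdentity q → DoubleIdentity (r + q * p)
    step q r r<p ih with p ∣? r + q * p
    ... | no  p∤b = double-identity-coprime p∤b
    ... | yes p∣b with refl ← ∣r+q*p⇒r≡0 q r<p p∣b = double-identity-multiple ih

  2<p : 2 < p
  2<p = ≤∧≢⇒< 1<p (λ 2≡p → p∤2 (subst (_∣ 2) 2≡p ∣-refl))

  p∸1≡1+[p∸2] : p ∸ 1 ≡ suc (p ∸ 2)
  p∸1≡1+[p∸2] = +-∸-assoc 1 (<⇒≤ 2<p)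

  instance
    p∸1≢0 : NonZero (p ∸ 1)
    p∸1≢0 = >-nonZero (m<n⇒0<n∸m 1<p)

  -- The only use of the hypothesis of the theorem.
  log-bound : ∀ {d v ℓ} → d ^ (p ∸ 1) ≤ p ^ (p ^ v * (p ∸ 2)) → p ^ ℓ ≤ d + d →
              (p ∸ 1) * ℓ < (p ∸ 1) + p ^ v * (p ∸ 2)
  log-bound {d} {v} {ℓ} hyp pˡ≤2d = ≰⇒> λ X≤[p∸1]ℓ → <-irrefl refl (begin-strict
    p ^ (p ∸ 1 + X)             ≤⟨ ^-monoʳ-≤ p X≤[p∸1]ℓ ⟩
    p ^ ((p ∸ 1) * ℓ)           ≡⟨ cong (p ^_) (*-comm (p ∸ 1) ℓ) ⟩
    p ^ (ℓ * (p ∸ 1))           ≡⟨ ^-*-assoc p ℓ (p ∸ 1) ⟨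
    (p ^ ℓ) ^ (p ∸ 1)           ≤⟨ ^-monoˡ-≤ (p ∸ 1) pˡ≤2d ⟩
    (d + d) ^ (p ∸ 1)           ≡⟨ cong (λ n → (d + n) ^ (p ∸ 1)) (+-identityʳ d) ⟨
    (2 * d) ^ (p ∸ 1)           ≡⟨ ^-distrib-* 2 d (p ∸ 1) ⟩
    2 ^ (p ∸ 1) * d ^ (p ∸ 1)   ≤⟨ *-monoʳ-≤ (2 ^ (p ∸ 1)) hyp ⟩
    2 ^ (p ∸ 1) * p ^ X         <⟨ *-monoˡ-< (p ^ X) {{m^n≢0 p X}} (^-monoˡ-< (p ∸ 1) 2<p) ⟩
    p ^ (p ∸ 1) * p ^ X         ≡⟨ ^-distribˡ-+-* p (p ∸ 1) X ⟨
    p ^ (p ∸ 1 + X)             ∎)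
    where
    open ≤-Reasoning
    X = p ^ v * (p ∸ 2)

  legendre-key-small : ∀ {d v m k} → p ^ v ∣ d → d ≡ m + k → 1 ≤ m → m ≤ p ^ v →
    legendre (d + d) + legendre k + legendre m + 1 ≤ legendre (d + k) + legendre d + m
  legendre-key-small {d} {v} {m} {k} pᵛ∣d d≡m+k 1≤m m≤pᵛ = begin
    legendre (d + d) + legendre k + legendre m + 1     ≡⟨ +-assoc _ (legendre m) 1 ⟩
    legendre (d + d) + legendre k + (legendre m + 1)
      ≤⟨ +-mono-≤ (≤-reflexive (legendre-double≡ d v pᵛ∣d d≡m+k 1≤m m≤pᵛ))
                  (≤-trans (≤-reflexive (+-comm (legendre m) 1)) (legendre< 1≤m)) ⟩
    legendre (d + k) + legendre d + m                  ∎
    where open ≤-Reasoning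

  legendre-key-large : ∀ {d v m k} → d ^ (p ∸ 1) ≤ p ^ (p ^ v * (p ∸ 2)) → d ≡ m + k → p ^ v < m →
    legendre (d + d) + legendre k + legendre m + 1 ≤ legendre (d + k) + legendre d + m
  legendre-key-large {d} {v} {m} {k} hyp d≡m+k pᵛ<m = begin
    legendre (d + d) + legendre k + legendre m + 1          ≡⟨ cong (_+ 1) (+-assoc (legendre (d + d)) _ _) ⟩
    legendre (d + d) + (legendre k + legendre m) + 1        ≤⟨ +-monoˡ-≤ 1 (+-mono-≤ ≤-carries superadditive) ⟩
    legendre (d + k) + legendre m + ℓ + legendre d + 1      ≡⟨ regroup (legendre (d + k)) (legendre m) ℓ (legendre d) ⟩
    legendre (d + k) + legendre d + (legendre m + ℓ + 1)    ≤⟨ +-monoʳ-≤ (legendre (d + k) + legendre d) carries-fit ⟩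
    legendre (d + k) + legendre d + m                       ∎
    where
    open ≤-Reasoning
    1≤m : 1 ≤ m
    1≤m = ≤-<-trans z≤n pᵛ<m
    instance
      2d≢0 : NonZero (d + d)
      2d≢0 = >-nonZero (≤-trans 1≤m (≤-trans (m≤m+n m k) (≤-trans (≤-reflexive (sym d≡m+k)) (m≤m+n d d))))
    ℓ = proj₁ (⌊log⌋-exists (d + d))
    pˡ≤2d = proj₁ (proj₂ (⌊log⌋-exists (d + d)))
    2d<pˡ⁺¹ = proj₂ (proj₂ (⌊log⌋-exists (d + d)))
    d+k+m≡d+d : d + k + m ≡ d + d
    d+k+m≡d+d = trans (+-assoc d k m) (cong (d +_) (trans (+-comm k m) (sym d≡m+k)))
    ≤-carries : legendre (d + d) ≤ legendre (d + k) + legendre m + ℓ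
    ≤-carries = subst (λ n → legendre n ≤ legendre (d + k) + legendre m + ℓ) d+k+m≡d+d
      (legendre-+-≤ ℓ {d + k} {m} (subst (_< p ^ suc ℓ) (sym d+k+m≡d+d) 2d<pˡ⁺¹))
    superadditive : legendre k + legendre m ≤ legendre d
    superadditive = subst (λ n → legendre k + legendre m ≤ legendre n) (trans (+-comm k m) (sym d≡m+k))
      (legendre-superadditive k m)
    carries-fit : legendre m + ℓ + 1 ≤ m
    carries-fit = subst (_≤ m) (+-comm 1 _) (sum-below (p ∸ 2)
      (subst (λ a → a * legendre m < m) p∸1≡1+[p∸2] ([p∸1]*legendre< 1≤m))
      (subst (λ a → a * ℓ < a + p ^ v * (p ∸ 2)) p∸1≡1+[p∸2] (log-bound {v = v} hyp pˡ≤2d))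
      pᵛ<m)
    regroup : ∀ a b c d → a + b + c + d + 1 ≡ a + d + (b + c + 1)
    regroup = solve-∀

  -- v_p(a_d) < v_p(a_k) + m for k = d − m, in terms of Legendre's formula
  legendre-key : ∀ {d v m k} → p ^ v ∣ d → d ^ (p ∸ 1) ≤ p ^ (p ^ v * (p ∸ 2)) → d ≡ m + k → 1 ≤ m →
    legendre (d + d) + legendre k + legendre m + 1 ≤ legendre (d + k) + legendre d + m
  legendre-key {v = v} {m} pᵛ∣d hyp d≡m+k 1≤m with m ≤? p ^ v
  ... | yes m≤pᵛ = legendre-key-small {v = v} pᵛ∣d d≡m+k 1≤m m≤pᵛ
  ... | no  m≰pᵛ = legendre-key-large {v = v} hyp d≡m+k (≰⇒> m≰pᵛ)

  v-intCoeff-gap : ∀ {d v k e e′} → p ^ v ∣ d → d ^ (p ∸ 1) ≤ p ^ (p ^ v * (p ∸ 2)) → k < d →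
                   v[ intCoeff d k ]≡ e → v[ intCoeff d d ]≡ e′ → e′ < e + (d ∸ k)
  v-intCoeff-gap {d} {v} {k} {e} {e′} pᵛ∣d hyp k<d v[aₖ] v[a_d] = +-cancelʳ-≤ S _ _ (begin
    suc e′ + S                                          ≡⟨ regroup₁ e′ (legendre d) (legendre k) (legendre m) ⟩
    e′ + (legendre d + legendre 0) + legendre k + legendre m + 1
                                                        ≡⟨ cong (λ n → n + legendre k + legendre m + 1) v[a_d]-legendre ⟩
    legendre (d + d) + legendre k + legendre m + 1      ≤⟨ legendre-key {v = v} pᵛ∣d hyp d≡m+k (m<n⇒0<n∸m k<d) ⟩
    legendre (d + k) + legendre d + m                   ≡⟨ cong (λ n → n + legendre d + m) (v[intCoeff] (<⇒≤ k<d) v[aₖ]) ⟨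
    e + (legendre k + legendre m) + legendre d + m      ≡⟨ regroup₂ e (legendre k) (legendre m) (legendre d) m ⟩
    e + m + S                                           ∎)
    where
    open ≤-Reasoning
    m = d ∸ k
    S = legendre d + legendre k + legendre m
    d≡m+k : d ≡ m + k
    d≡m+k = sym (m∸n+n≡m (<⇒≤ k<d))
    v[a_d]-legendre : e′ + (legendre d + legendre 0) ≡ legendre (d + d)
    v[a_d]-legendre = trans (cong (λ n → e′ + (legendre d + legendre n)) (sym (n∸n≡0 d))) (v[intCoeff] {d} ≤-refl v[a_d])
    regroup₁ : ∀ e a b c → suc e + (a + b + c) ≡ e + (a + 0) + b + c + 1
    regroup₁ = solve-∀
    regroup₂ : ∀ e b c a m → e + (b + c) + a + m ≡ e + m + (a + b + c)
    regroup₂ = solve-∀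

  ∣lowerTerm : ∀ {d v N T k e′} → p ^ v ∣ d → d ^ (p ∸ 1) ≤ p ^ (p ^ v * (p ∸ 2)) → p ∣ ℤ.∣ T ∣ →
               k < d → v[ intCoeff d d ]≡ e′ → p ^ suc e′ ∣ ℤ.∣ T ℤ.^ (d ∸ k) ℤ.* besselTerm d N k ∣
  ∣lowerTerm {d} {v} {N} {T} {k} {e′} pᵛ∣d hyp p∣T k<d v[a_d] = begin
    p ^ suc e′                                   ∣⟨ m^e∣m^f p (v-intCoeff-gap {v = v} pᵛ∣d hyp k<d v[aₖ] v[a_d]) ⟩
    p ^ (e + m)                                  ≡⟨ trans (^-distribˡ-+-* p e m) (*-comm (p ^ e) (p ^ m)) ⟩
    p ^ m * p ^ e                                ∣⟨ *-pres-∣ (^-monoˡ-∣ m p∣T) (pᵉ∣n v[aₖ]) ⟩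
    ℤ.∣ T ∣ ^ m * intCoeff d k                   ∣⟨ *-monoʳ-∣ (ℤ.∣ T ∣ ^ m) (m∣m*n (ℤ.∣ N ∣ ^ k)) ⟩
    ℤ.∣ T ∣ ^ m * (intCoeff d k * ℤ.∣ N ∣ ^ k)  ≡⟨ cong₂ _*_ (∣i^k∣≡∣i∣^k T m) (∣besselTerm∣ d N k) ⟨
    ℤ.∣ T ℤ.^ m ∣ * ℤ.∣ besselTerm d N k ∣      ≡⟨ ℤ.abs-* (T ℤ.^ m) (besselTerm d N k) ⟨
    ℤ.∣ T ℤ.^ m ℤ.* besselTerm d N k ∣          ∎
    where
    open ∣-Reasoning
    m = d ∸ k
    instance _ = intCoeff≢0 {d} {k} (<⇒≤ k<d)
    e = proj₁ (v-exists (intCoeff d k))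
    v[aₖ] = proj₂ (v-exists (intCoeff d k))

  horner-bessel≢0-p∣T : ∀ {d v N T} → p ^ v ∣ d → d ^ (p ∸ 1) ≤ p ^ (p ^ v * (p ∸ 2)) →
                        p ∣ ℤ.∣ T ∣ → ¬ p ∣ ℤ.∣ N ∣ → horner (besselTerm d N) T d ≢ 0ℤ
  horner-bessel≢0-p∣T {d} {v} {N} {T} pᵛ∣d hyp p∣T p∤N horner≡0 =
    pᵉ⁺¹∤n (v-* v[a_d] (v-^-coprime d p∤N))
      (subst₂ (λ e n → p ^ suc e ∣ n) (sym (+-identityʳ e′)) (∣besselTerm∣ d N d) (ℤ∣.∣⇒∣ᵤ p^[e′+1]∣top))
    where
    instance _ = intCoeff≢0 {d} ≤-refl
    e′ = proj₁ (v-exists (intCoeff d d))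
    v[a_d] = proj₂ (v-exists (intCoeff d d))
    p^[e′+1]∣top : ℤ.+ (p ^ suc e′) ∣ℤ besselTerm d N d
    p^[e′+1]∣top = ∣horner⇒∣top (besselTerm d N) T d
      (λ k<d → ℤ∣.∣ᵤ⇒∣ (∣lowerTerm {v = v} pᵛ∣d hyp p∣T k<d v[a_d]))
      (subst (ℤ.+ (p ^ suc e′) ∣ℤ_) (sym horner≡0) (ℤ∣.divides 0ℤ refl))

module _ {p : ℕ} (p-prime : Prime p) where

  open Valuation p-prime

  horner-bessel≢0-p∤T : ∀ {d N T} → p ∣ d → ¬ p ∣ ℤ.∣ T ∣ → horner (besselTerm d N) T d ≢ 0ℤ
  horner-bessel≢0-p∤T {d} {N} {T} p∣d p∤T horner≡0 =
    p∤T (∣^⇒∣ d (subst (p ∣_) (∣i^k∣≡∣i∣^k T d) (ℤ∣.∣⇒∣ᵤ p∣T^d)))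
    where
    p∣lower : ∀ {k} → 1 ≤ k → k ≤ d → ℤ.+ p ∣ℤ besselTerm d N k
    p∣lower {k} 1≤k k≤d =
      ℤ∣.∣m⇒∣m*n {m = ℤ.+ intCoeff d k} (N ℤ.^ k) (ℤ∣.∣ᵤ⇒∣ (∣-trans p∣d (d∣intCoeff 1≤k k≤d)))
    t₀≡1 : besselTerm d N 0 ≡ 1ℤ
    t₀≡1 = trans (ℤ.*-identityʳ _) (cong ℤ.+_ (intCoeff-0 d))
    p∣T^d : ℤ.+ p ∣ℤ T ℤ.^ d
    p∣T^d = subst (ℤ.+ p ∣ℤ_)
      (trans (cong₂ (λ h t → ℤ.- (h ℤ.- T ℤ.^ d ℤ.* t)) horner≡0 t₀≡1) (negate (T ℤ.^ d)))
      (ℤ∣.∣m⇒∣-m (∣horner-leadingTerm (besselTerm d N) T d p∣lower))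
      where
      negate : ∀ x → ℤ.- (0ℤ ℤ.- x ℤ.* 1ℤ) ≡ x
      negate = ℤ-Solver.solve-∀

coprime⇒∤ : ∀ {p a b} → 1 < p → .(Coprime a b) → p ∣ b → ¬ p ∣ a
coprime⇒∤ 1<p coprime p∣b p∣a = ⊥-elim-irr (<-irrefl (sym (coprime (p∣a , p∣b))) 1<p)

odd⇒∤2 : ∀ {p d} → Prime p → p ∣ d → ¬ 2 ∣ d → ¬ p ∣ 2
odd⇒∤2 {p} p-prime p∣d 2∤d p∣2 = 2∤d (subst (_∣ _) (≤-antisym (∣⇒≤ p∣2) (Valuation.1<p p-prime)) p∣d)

mainTheorem8 : (d : ℕ) → 0 < d → ¬ (2 ∣ d) →
    (p : ℕ) → Prime p → p ∣ d →
    (v : ℕ) → p ^ v ∣ d → ¬ (p ^ suc v ∣ d) →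
    d ^ (p ∸ 1) ≤ p ^ (p ^ v * (p ∸ 2)) →
    (x : ℚ) → evalB d x ≢ 0ℚ
mainTheorem8 d _ 2∤d p p-prime p∣d v pᵛ∣d _ hyp (mkℚ N Q-1 coprime) evalB≡0
  with evalB≡0⇒horner≡0 d N Q-1 coprime evalB≡0 | p ∣? suc Q-1
... | horner≡0 | no  p∤Q =
  horner-bessel≢0-p∤T p-prime p∣d
    ([ odd⇒∤2 p-prime p∣d 2∤d , p∤Q ]′ ∘ euclidsLemma 2 (suc Q-1) p-prime) horner≡0
... | horner≡0 | yes p∣Q =
  OddPrime.horner-bessel≢0-p∣T p-prime (odd⇒∤2 p-prime p∣d 2∤d) {v = v} pᵛ∣d hyp (∣n⇒∣m*n 2 p∣Q)
    (coprime⇒∤ (Valuation.1<p p-prime) coprime p∣Q) horner≡0
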